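{- Let $S\ge5$ be an odd integer not divisible by $3$. Consider two processes, both with $G^{(0)}=G_S$, thresholds $\alpha=\beta=2$, and interaction set $C^{(t)}$ consisting of all pairs of distinct vertices at distance at most $2$ in the current graph: the first with energy $\mathcal{E}^{(t)}(u,v)=|N_{G^{(t)}}(u)\cap N_{G^{(t)}}(v)|$, the second with energy $\mathcal{E}^{(t)}(u,v)=|N_{G^{(t)}}(u)\cap N_{G^{(t)}}(v)|+|E^{(t)}(u,v)|+|E(G^{(t)}[N_{G^{(t)}}(u)\cap N_{G^{(t)}}(v)])|$. Then the two processes produce the same sequence of graphs.
   Context: $G_S$ is the graph on $\{0,\dots,S-1\}^2$ in which $(x,y)$ is adjacent to $(x,y\pm1\bmod S)$ and $(x\pm1\bmod S,y)$. $|E^{(t)}(u,v)|$ is $1$ if $\{u,v\}$ is an edge of $G^{(t)}$ and $0$ otherwise; $|E(G^{(t)}[X])|$ is the number of edges of $G^{(t)}$ with both endpoints in $X$. Process: $G^{(t+1)}$ on the same vertex set is defined by: for each pair $\{u,v\}\in C^{(t)}$, it is an edge of $G^{(t+1)}$ iff $\mathcal{E}^{(t)}(u,v)\ge2$; pairs not in $C^{(t)}$ keep their status. -}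

module Defs where

open import Data.Bool using (Bool; true; false; _∧_; _∨_; not; if_then_else_)
open import Data.Nat using (ℕ; zero; suc; _+_; _≡ᵇ_; _≤ᵇ_)
open import Data.Fin using (Fin; toℕ)
open import Data.Fin.Properties using (_≟_)
open import Data.Product using (_×_; _,_)
open import Data.List using (List; []; _∷_; _++_; map; length; cartesianProduct; allFin)
open import Relation.Nullary.Decidable using (⌊_⌋)
open import Data.Bool.ListAction using (any)

Vertex : ℕ → Set
Vertex S = Fin S × Fin S

Graph : ℕ → Set
Graph S = Vertex S → Vertex S → Bool

vertices : (S : ℕ) → List (Vertex S)
vertices S = cartesianProduct (allFin S) (allFin S)

_==V_ : ∀ {S} → Vertex S → Vertex S → Bool
(x , y) ==V (x' , y') = ⌊ x ≟ x' ⌋ ∧ ⌊ y ≟ y' ⌋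

-- b ≡ a + 1 (mod S), for a b ∈ {0,…,S-1}
succMod : (S : ℕ) → Fin S → Fin S → Bool
succMod S a b = (suc (toℕ a) ≡ᵇ toℕ b) ∨ ((suc (toℕ a) ≡ᵇ S) ∧ (toℕ b ≡ᵇ 0))

pm1 : (S : ℕ) → Fin S → Fin S → Bool
pm1 S a b = succMod S a b ∨ succMod S b a

torus : (S : ℕ) → Graph S
torus S (x , y) (x' , y') =
  (⌊ x ≟ x' ⌋ ∧ pm1 S y y') ∨ (⌊ y ≟ y' ⌋ ∧ pm1 S x x')

filterᵇ : ∀ {A : Set} → (A → Bool) → List A → List A
filterᵇ p [] = []
filterᵇ p (w ∷ ws) = if p w then w ∷ filterᵇ p ws else filterᵇ p ws

commonNbrs : ∀ {S} → Graph S → Vertex S → Vertex S → List (Vertex S)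
commonNbrs {S} G u v = filterᵇ (λ w → G u w ∧ G v w) (vertices S)

pairsOf : ∀ {A : Set} → List A → List (A × A)
pairsOf [] = []
pairsOf (a ∷ as) = map (a ,_) as ++ pairsOf as

countTrue : ∀ {A : Set} → (A → Bool) → List A → ℕ
countTrue p [] = 0
countTrue p (a ∷ as) = if p a then suc (countTrue p as) else countTrue p as

commonCount : ∀ {S} → Graph S → Vertex S → Vertex S → ℕ
commonCount G u v = length (commonNbrs G u v)

edgeInd : ∀ {S} → Graph S → Vertex S → Vertex S → ℕ
edgeInd G u v = if G u v then 1 else 0

inducedEdges : ∀ {S} → Graph S → Vertex S → Vertex S → ℕ
inducedEdges G u v = countTrue (λ { (a , b) → G a b }) (pairsOf (commonNbrs G u v))

Energy : Set
Energy = ∀ {S} → Graph S → Vertex S → Vertex S → ℕ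

energy₁ : Energy
energy₁ G u v = commonCount G u v

energy₂ : Energy
energy₂ G u v = commonCount G u v + edgeInd G u v + inducedEdges G u v

inC : ∀ {S} → Graph S → Vertex S → Vertex S → Bool
inC {S} G u v = not (u ==V v) ∧ (G u v ∨ any (λ w → G u w ∧ G w v) (vertices S))

step : Energy → ∀ {S} → Graph S → Graph S
step E G u v = if inC G u v then (2 ≤ᵇ E G u v) else G u v

process : Energy → (S : ℕ) → ℕ → Graph S
process E S zero = torus S
process E S (suc t) = step E (process E S t)

module Submission where

-- Both processes keep G^(t) equal to the Cayley graph of ℤ_S² with generators
-- ±A_t, ±B_t, where A_0 = e₁, B_0 = e₂, A_{t+1} = A_t + B_t, B_{t+1} = A_t − B_t.
-- For odd S the twist (α , β) ↦ (α + β , α − β) is invertible modulo S, so A_t, B_t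
-- stay a basis of ℤ_S², and for S ≥ 5 coordinates of absolute value ≤ 2 are read
-- off uniquely modulo S.  A finite check on the generators ±e₁, ±e₂ then shows that
-- in this Cayley graph (i) no edge lies in a triangle, and (ii) u ≠ v have two
-- distinct common neighbours exactly when v − u = ±A_t ± B_t, a generator at time
-- t+1.  By (ii) the first energy produces the Cayley graph at time t+1; by (i) the
-- extra terms of the second energy never change whether the threshold 2 is reached.

open import Data.Bool using (Bool; true; false; T; not; _∧_; if_then_else_)
open import Data.Bool.Properties using (T-∧; T-∨; T-not-≡; if-cong-then)
open import Data.Nat using (ℕ; zero; suc)
import Data.Nat.Properties as ℕ
import Data.Nat as ℕ
open import Data.List using (List; []; _∷_; length)
open import Data.List.Membership.Propositional using (_∈_; lose)
open import Data.List.Membership.Propositional.Properties using (∈-cartesianProduct⁺; ∈-allFin)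
open import Data.List.Relation.Unary.Any using (here; there)
open import Data.List.Relation.Unary.Any.Properties using (any⁺)
open import Data.List.Relation.Unary.All as All using ()
open import Data.List.Relation.Unary.AllPairs using (_∷_)
open import Data.List.Relation.Unary.Unique.Propositional using (Unique)
open import Data.List.Relation.Unary.Unique.Propositional.Properties using (cartesianProduct⁺; allFin⁺)
open import Data.Fin using (Fin; zero; suc; toℕ; fromℕ<)
import Data.Fin.Properties as Fin
open import Data.Product using (∃; _×_; _,_; proj₁; proj₂)
open import Data.Sum using (_⊎_; inj₁; inj₂; [_,_]′)
open import Data.Empty using (⊥-elim)
open import Function using (Equivalence; _⇔_; mk⇔; _∘_; _$_)
open import Relation.Nullary using (¬_)
open import Relation.Nullary.Decidable using (⌊_⌋; toWitness; fromWitness)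
open import Relation.Binary.PropositionalEquality using (_≡_; _≢_; refl; sym; trans; cong; cong₂; subst; subst₂)
open import Defs

T-injective : ∀ {a b} → (T a → T b) → (T b → T a) → a ≡ b
T-injective {false} {false} _ _   = refl
T-injective {false} {true}  _ b⇒a = ⊥-elim (b⇒a _)
T-injective {true}  {false} a⇒b _ = ⊥-elim (a⇒b _)
T-injective {true}  {true}  _ _   = refl

T-if : ∀ b {x y} → T (if b then x else y) → (T b × T x) ⊎ (¬ T b × T y)
T-if true  h = inj₁ (_ , h)
T-if false h = inj₂ ((λ ()) , h)

T-if-then : ∀ b {x y} → T b → T x → T (if b then x else y)
T-if-then true _ h = h

module Counting {A : Set} (p : A → Bool) where

  count : List A → ℕ
  count xs = length (filterᵇ p xs)

  count-∷ : ∀ x xs → count xs ℕ.≤ count (x ∷ xs)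
  count-∷ x xs with p x
  ... | true  = ℕ.n≤1+n _
  ... | false = ℕ.≤-refl

  member⇒1≤count : ∀ {w} xs → w ∈ xs → T (p w) → 1 ℕ.≤ count xs
  member⇒1≤count (x ∷ xs) (here refl) px with p x
  ... | true = ℕ.s≤s ℕ.z≤n
  member⇒1≤count (x ∷ xs) (there w∈xs) pw = ℕ.≤-trans (member⇒1≤count xs w∈xs pw) (count-∷ x xs)

  members⇒2≤count : ∀ {w₁ w₂} xs → w₁ ∈ xs → w₂ ∈ xs → w₁ ≢ w₂ → T (p w₁) → T (p w₂) → 2 ℕ.≤ count xs
  members⇒2≤count (x ∷ xs) (here refl) (here refl) w₁≢w₂ _ _ = ⊥-elim (w₁≢w₂ refl)
  members⇒2≤count (x ∷ xs) (here refl) (there w₂∈xs) _ px pw₂ with p x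
  ... | true = ℕ.s≤s (member⇒1≤count xs w₂∈xs pw₂)
  members⇒2≤count (x ∷ xs) (there w₁∈xs) (here refl) _ pw₁ px with p x
  ... | true = ℕ.s≤s (member⇒1≤count xs w₁∈xs pw₁)
  members⇒2≤count (x ∷ xs) (there w₁∈xs) (there w₂∈xs) w₁≢w₂ pw₁ pw₂ =
    ℕ.≤-trans (members⇒2≤count xs w₁∈xs w₂∈xs w₁≢w₂ pw₁ pw₂) (count-∷ x xs)

  1≤count⇒member : ∀ xs → 1 ℕ.≤ count xs → ∃ λ w → w ∈ xs × T (p w)
  1≤count⇒member (x ∷ xs) 1≤c with p x in px
  ... | true  = x , here refl , subst T (sym px) _
  ... | false with 1≤count⇒member xs 1≤c
  ...   | w , w∈xs , pw = w , there w∈xs , pw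

  2≤count⇒members : ∀ xs → Unique xs → 2 ℕ.≤ count xs → ∃ λ w₁ → ∃ λ w₂ → w₁ ≢ w₂ × T (p w₁) × T (p w₂)
  2≤count⇒members (x ∷ xs) (x∉xs ∷ uniq) 2≤c with p x in px
  ... | true with 1≤count⇒member xs (ℕ.≤-pred 2≤c)
  ...   | w , w∈xs , pw = x , w , All.lookup x∉xs w∈xs , subst T (sym px) _ , pw
  2≤count⇒members (x ∷ xs) (_ ∷ uniq) 2≤c | false = 2≤count⇒members xs uniq 2≤c

  no-member⇒empty : ∀ xs → (∀ w → ¬ T (p w)) → filterᵇ p xs ≡ []
  no-member⇒empty []       _ = refl
  no-member⇒empty (x ∷ xs) none with p x in px
  ... | true  = ⊥-elim (none x (subst T (sym px) _))
  ... | false = no-member⇒empty xs none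

-- Adding the edge indicator and the number of induced edges to |L| does not
-- change whether 2 is reached, provided the indicator forces L to be empty:
-- a list with fewer than two entries has no pairs at all.
pair-threshold : ∀ {A : Set} (L : List A) (q : A × A → Bool) (b : Bool) → (T b → L ≡ []) →
  (2 ℕ.≤ᵇ (length L ℕ.+ (if b then 1 else 0) ℕ.+ countTrue q (pairsOf L))) ≡ (2 ℕ.≤ᵇ length L)
pair-threshold []           q true  _     = refl
pair-threshold []           q false _     = refl
pair-threshold (x ∷ [])     q true  empty with empty _
... | ()
pair-threshold (x ∷ [])     q false _     = refl
pair-threshold (x ∷ y ∷ zs) q b     _     = refl

energies-agree-at-2 : ∀ {S} (G : Graph S) u v → (T (G u v) → commonNbrs G u v ≡ []) →
  (2 ℕ.≤ᵇ energy₂ G u v) ≡ (2 ℕ.≤ᵇ energy₁ G u v)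
energies-agree-at-2 G u v = pair-threshold (commonNbrs G u v) _ (G u v)

vertex∈vertices : ∀ {S} (u : Vertex S) → u ∈ vertices S
vertex∈vertices (x , y) = ∈-cartesianProduct⁺ (∈-allFin x) (∈-allFin y)

vertices-unique : ∀ S → Unique (vertices S)
vertices-unique S = cartesianProduct⁺ (allFin⁺ S) (allFin⁺ S)

==V⇒≡ : ∀ {S} {u v : Vertex S} → T (u ==V v) → u ≡ v
==V⇒≡ {u = x , y} {x' , y'} h =
  let (x≡x' , y≡y') = Equivalence.to (T-∧ {⌊ x Fin.≟ x' ⌋}) h in cong₂ _,_ (toWitness x≡x') (toWitness y≡y')

==V-refl : ∀ {S} (u : Vertex S) → T (u ==V u)
==V-refl (x , y) =
  Equivalence.from (T-∧ {⌊ x Fin.≟ x ⌋}) (fromWitness {a? = x Fin.≟ x} refl , fromWitness {a? = y Fin.≟ y} refl)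

inC⇒≢ : ∀ {S} (G : Graph S) u v → T (inC G u v) → u ≢ v
inC⇒≢ G u .u h refl = subst T (Equivalence.to T-not-≡ (proj₁ (Equivalence.to T-∧ h))) (==V-refl u)

module _ {S} (G : Graph S) {u v : Vertex S} (u≢v : u ≢ v) where

  not-==V : T (not (u ==V v))
  not-==V with u ==V v in e
  ... | true  = ⊥-elim (u≢v (==V⇒≡ (subst T (sym e) _)))
  ... | false = _

  edge⇒inC : T (G u v) → T (inC G u v)
  edge⇒inC uv = Equivalence.from T-∧ (not-==V , Equivalence.from T-∨ (inj₁ uv))

  path⇒inC : ∀ {w} → T (G u w) → T (G w v) → T (inC G u v)
  path⇒inC {w} uw wv = Equivalence.from T-∧ (not-==V , Equivalence.from (T-∨ {G u v}) (inj₂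
    (any⁺ (λ w → G u w ∧ G w v) (lose (vertex∈vertices w) (Equivalence.from T-∧ (uw , wv))))))

module Lattice where

  open import Data.Nat using (_≤_; _<_; NonZero)
  import Data.Nat.Divisibility as ℕ
  open import Data.Integer using (ℤ; +_; _+_; _-_; _*_; -_; ∣_∣; 0ℤ; 1ℤ; -1ℤ)
  import Data.Integer as ℤ
  import Data.Integer.Properties as ℤ
  import Data.Integer.DivMod as ℤ
  open import Data.Integer.Divisibility.Signed
    using (_∣_; divides; ∣-refl; ∣m⇒∣-m; ∣m∣n⇒∣m+n; ∣m∣n⇒∣m-n; ∣n⇒∣m*n; ∣m⇒∣m*n; ∣⇒∣ᵤ)
  open import Data.Integer.Tactic.RingSolver using (solve-∀)
  open import Data.Fin.Properties using (all?; any?)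
  open import Data.Product.Properties using (≡-dec)
  open import Relation.Nullary using (¬?; _×-dec_; _→-dec_; contradiction)
  open import Relation.Nullary.Decidable using (from-yes)
  open import Relation.Binary.Definitions using (DecidableEquality)
  open import Relation.Unary using (Decidable)

  IsOdd : ℤ → Set
  IsOdd m = ∃ λ k → m ≡ 1ℤ + + 2 * k

  module Congruence (m : ℤ) where

    infix 4 _≈_
    record _≈_ (a b : ℤ) : Set where
      constructor ≈-intro
      field m∣a-b : m ∣ a - b

    ≈-reflexive : ∀ {a b} → a ≡ b → a ≈ b
    ≈-reflexive {a} refl = ≈-intro $ subst (m ∣_) (sym (ℤ.+-inverseʳ a)) (divides {m} {0ℤ} 0ℤ (sym (ℤ.*-zeroˡ m)))

    ≈-refl : ∀ {a} → a ≈ a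
    ≈-refl = ≈-reflexive refl

    ≈-sym : ∀ {a b} → a ≈ b → b ≈ a
    ≈-sym {a} {b} (≈-intro p) = ≈-intro $ subst (m ∣_) (identity a b) (∣m⇒∣-m p)
      where
      identity : ∀ a b → - (a - b) ≡ b - a
      identity = solve-∀

    ≈-trans : ∀ {a b c} → a ≈ b → b ≈ c → a ≈ c
    ≈-trans {a} {b} {c} (≈-intro p) (≈-intro q) = ≈-intro $ subst (m ∣_) (identity a b c) (∣m∣n⇒∣m+n p q)
      where
      identity : ∀ a b c → (a - b) + (b - c) ≡ a - c
      identity = solve-∀

    ≈-+ : ∀ {a b c d} → a ≈ b → c ≈ d → a + c ≈ b + d
    ≈-+ {a} {b} {c} {d} (≈-intro p) (≈-intro q) = ≈-intro $ subst (m ∣_) (identity a b c d) (∣m∣n⇒∣m+n p q)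
      where
      identity : ∀ a b c d → (a - b) + (c - d) ≡ (a + c) - (b + d)
      identity = solve-∀

    ≈-- : ∀ {a b c d} → a ≈ b → c ≈ d → a - c ≈ b - d
    ≈-- {a} {b} {c} {d} (≈-intro p) (≈-intro q) = ≈-intro $ subst (m ∣_) (identity a b c d) (∣m∣n⇒∣m-n p q)
      where
      identity : ∀ a b c d → (a - b) - (c - d) ≡ (a - c) - (b - d)
      identity = solve-∀

    ≈-neg : ∀ {a b} → a ≈ b → - a ≈ - b
    ≈-neg {a} {b} (≈-intro p) = ≈-intro $ subst (m ∣_) (identity a b) (∣m⇒∣-m p)
      where
      identity : ∀ a b → - (a - b) ≡ - a - - b
      identity = solve-∀

    ≈-move : ∀ a b {c} → a - b ≈ c → a ≈ c + b
    ≈-move a b p = ≈-trans (≈-reflexive (identity a b)) (≈-+ p ≈-refl)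
      where
      identity : ∀ a b → a ≡ (a - b) + b
      identity = solve-∀

    ≈-flip : ∀ a b {c} → a - b ≈ - c → b - a ≈ c
    ≈-flip a b {c} p = ≈-trans (≈-reflexive (identity a b)) (≈-trans (≈-neg p) (≈-reflexive (ℤ.neg-involutive c)))
      where
      identity : ∀ a b → b - a ≡ - (a - b)
      identity = solve-∀

    -- Modulo m = 1 + 2k, 2a ≡ 0 forces a ≡ 0, since a = m·a − k·(a + a).
    ≈-halve : ∀ {a} → IsOdd m → a + a ≈ 0ℤ → a ≈ 0ℤ
    ≈-halve {a} (k , m-odd) (≈-intro 2a≈0) =
      ≈-intro $ subst (m ∣_) (trans (cong (λ x → x * a - k * ((a + a) - 0ℤ)) m-odd) (identity k a))
        (∣m∣n⇒∣m-n (∣m⇒∣m*n a (∣-refl {m})) (∣n⇒∣m*n k 2a≈0))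
      where
      identity : ∀ k a → (1ℤ + + 2 * k) * a - k * ((a + a) - 0ℤ) ≡ a - 0ℤ
      identity = solve-∀

    ≈-close⇒≡ : ∀ {a b} → a ≈ b → ∣ a - b ∣ < ∣ m ∣ → a ≡ b
    ≈-close⇒≡ {a} {b} (≈-intro a≈b) close with ∣ a - b ∣ in eq
    ... | zero  = ℤ.i-j≡0⇒i≡j a b (ℤ.∣i∣≡0⇒i≡0 eq)
    ... | suc d = contradiction (subst (∣ m ∣ ℕ.∣_) eq (∣⇒∣ᵤ a≈b)) (ℕ.>⇒∤ close)

    ≈-bounded⇒≡ : 5 ≤ ∣ m ∣ → ∀ {a b} → a ≈ b → ∣ a ∣ ≤ 2 → ∣ b ∣ ≤ 2 → a ≡ b
    ≈-bounded⇒≡ 5≤m {a} {b} a≈b a≤2 b≤2 =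
      ≈-close⇒≡ a≈b (ℕ.≤-<-trans (ℤ.∣i-j∣≤∣i∣+∣j∣ a b) (ℕ.<-≤-trans (ℕ.s≤s (ℕ.+-mono-≤ a≤2 b≤2)) 5≤m))

  infixl 6 _+²_ _-²_
  infixl 7 _·_
  infix  8 -²_

  ℤ² : Set
  ℤ² = ℤ × ℤ

  0² : ℤ²
  0² = 0ℤ , 0ℤ

  _+²_ _-²_ : ℤ² → ℤ² → ℤ²
  (a₁ , a₂) +² (b₁ , b₂) = a₁ + b₁ , a₂ + b₂
  (a₁ , a₂) -² (b₁ , b₂) = a₁ - b₁ , a₂ - b₂

  -²_ : ℤ² → ℤ²
  -² (a₁ , a₂) = - a₁ , - a₂

  _·_ : ℤ → ℤ² → ℤ²
  α · (a₁ , a₂) = α * a₁ , α * a₂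

  -²-self : ∀ a → a -² a ≡ 0²
  -²-self (a₁ , a₂) = cong₂ _,_ (ℤ.+-inverseʳ a₁) (ℤ.+-inverseʳ a₂)

  -²-cancelˡ : ∀ a b → a -² (a -² b) ≡ b
  -²-cancelˡ (a₁ , a₂) (b₁ , b₂) = cong₂ _,_ (identity a₁ b₁) (identity a₂ b₂)
    where
    identity : ∀ a b → a - (a - b) ≡ b
    identity = solve-∀

  comb : ℤ² → ℤ² → ℤ² → ℤ²
  comb a b (α , β) = α · a +² β · b

  -- Passing from the frame (a , b) to (a + b , a − b) twists the coordinates.
  twist : ℤ² → ℤ²
  twist (α , β) = α + β , α - β

  comb-standard : ∀ c → comb (1ℤ , 0ℤ) (0ℤ , 1ℤ) c ≡ c
  comb-standard (α , β) = cong₂ _,_ (first α β) (second α β)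
    where
    first : ∀ α β → α * 1ℤ + β * 0ℤ ≡ α
    first = solve-∀
    second : ∀ α β → α * 0ℤ + β * 1ℤ ≡ β
    second = solve-∀

  comb-twist : ∀ a b c → comb (a +² b) (a -² b) c ≡ comb a b (twist c)
  comb-twist (a₁ , a₂) (b₁ , b₂) (α , β) = cong₂ _,_ (identity α β a₁ b₁) (identity α β a₂ b₂)
    where
    identity : ∀ α β a b → α * (a + b) + β * (a - b) ≡ (α + β) * a + (α - β) * b
    identity = solve-∀

  comb-linear : ∀ a b c c' → comb a b c -² comb a b c' ≡ comb a b (c -² c')
  comb-linear (a₁ , a₂) (b₁ , b₂) (α , β) (α' , β') =
    cong₂ _,_ (identity α β α' β' a₁ b₁) (identity α β α' β' a₂ b₂)
    where
    identity : ∀ α β α' β' a b → (α * a + β * b) - (α' * a + β' * b) ≡ (α - α') * a + (β - β') * b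
    identity = solve-∀

  comb-neg : ∀ a b c → comb a b (-² c) ≡ -² comb a b c
  comb-neg (a₁ , a₂) (b₁ , b₂) (α , β) = cong₂ _,_ (identity α β a₁ b₁) (identity α β a₂ b₂)
    where
    identity : ∀ α β a b → (- α) * a + (- β) * b ≡ - (α * a + β * b)
    identity = solve-∀

  comb-zero : ∀ a b → comb a b 0² ≡ 0²
  comb-zero (a₁ , a₂) (b₁ , b₂) = cong₂ _,_ (identity a₁ b₁) (identity a₂ b₂)
    where
    identity : ∀ a b → 0ℤ * a + 0ℤ * b ≡ 0ℤ
    identity = solve-∀

  frame : ℕ → ℤ² × ℤ²
  frame zero    = (1ℤ , 0ℤ) , (0ℤ , 1ℤ)
  frame (suc t) = let (a , b) = frame t in a +² b , a -² b

  lattice : ℕ → ℤ² → ℤ²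
  lattice t c = let (a , b) = frame t in comb a b c

  lattice-zero : ∀ c → lattice zero c ≡ c
  lattice-zero = comb-standard

  lattice-suc : ∀ t c → lattice (suc t) c ≡ lattice t (twist c)
  lattice-suc t = let (a , b) = frame t in comb-twist a b

  lattice-linear : ∀ t c c' → lattice t c -² lattice t c' ≡ lattice t (c -² c')
  lattice-linear t = let (a , b) = frame t in comb-linear a b

  lattice-neg : ∀ t c → lattice t (-² c) ≡ -² lattice t c
  lattice-neg t = let (a , b) = frame t in comb-neg a b

  lattice-null : ∀ t → lattice t 0² ≡ 0²
  lattice-null t = let (a , b) = frame t in comb-zero a b

  Bounded : ℤ² → Set
  Bounded (α , β) = ∣ α ∣ ≤ 2 × ∣ β ∣ ≤ 2

  module Congruence² (m : ℤ) where

    open Congruence m public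

    infix 4 _≋_
    record _≋_ (a b : ℤ²) : Set where
      constructor _,_
      field
        first  : proj₁ a ≈ proj₁ b
        second : proj₂ a ≈ proj₂ b

    ≋-reflexive : ∀ {a b} → a ≡ b → a ≋ b
    ≋-reflexive refl = ≈-refl , ≈-refl

    ≋-refl : ∀ {a} → a ≋ a
    ≋-refl = ≋-reflexive refl

    ≋-sym : ∀ {a b} → a ≋ b → b ≋ a
    ≋-sym (p₁ , p₂) = ≈-sym p₁ , ≈-sym p₂

    ≋-trans : ∀ {a b c} → a ≋ b → b ≋ c → a ≋ c
    ≋-trans (p₁ , p₂) (q₁ , q₂) = ≈-trans p₁ q₁ , ≈-trans p₂ q₂

    ≋-+ : ∀ {a b c d} → a ≋ b → c ≋ d → a +² c ≋ b +² d
    ≋-+ (p₁ , p₂) (q₁ , q₂) = ≈-+ p₁ q₁ , ≈-+ p₂ q₂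

    ≋-- : ∀ {a b c d} → a ≋ b → c ≋ d → a -² c ≋ b -² d
    ≋-- (p₁ , p₂) (q₁ , q₂) = ≈-- p₁ q₁ , ≈-- p₂ q₂

    ≋-neg : ∀ {a b} → a ≋ b → -² a ≋ -² b
    ≋-neg (p₁ , p₂) = ≈-neg p₁ , ≈-neg p₂

    ≋-cancel : ∀ {a b} → a ≋ b → a -² b ≋ 0²
    ≋-cancel {a} {b} p = subst (a -² b ≋_) (-²-self b) (≋-- p ≋-refl)

    ≋-uncancel : ∀ {a b} → a -² b ≋ 0² → a ≋ b
    ≋-uncancel {a} {b} p = subst₂ _≋_ (-²+²-cancel a b) (0²+² b) (≋-+ p (≋-refl {b}))
      where
      -²+²-cancel : ∀ a b → a -² b +² b ≡ a
      -²+²-cancel (a₁ , a₂) (b₁ , b₂) = cong₂ _,_ (identity a₁ b₁) (identity a₂ b₂)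
        where
        identity : ∀ a b → a - b + b ≡ a
        identity = solve-∀
      0²+² : ∀ b → 0² +² b ≡ b
      0²+² (b₁ , b₂) = cong₂ _,_ (ℤ.+-identityˡ b₁) (ℤ.+-identityˡ b₂)

    -- For odd m the twist is injective modulo m: (α+β) ± (α−β) = 2α, 2β.
    twist-faithful : ∀ {c} → IsOdd m → twist c ≋ 0² → c ≋ 0²
    twist-faithful {α , β} m-odd (p , q) =
        ≈-halve m-odd (≈-trans (≈-reflexive (sum α β)) (≈-+ p q))
      , ≈-halve m-odd (≈-trans (≈-reflexive (difference α β)) (≈-- p q))
      where
      sum : ∀ α β → α + α ≡ (α + β) + (α - β)
      sum = solve-∀
      difference : ∀ α β → β + β ≡ (α + β) - (α - β)
      difference = solve-∀

    lattice-faithful : IsOdd m → ∀ t c → lattice t c ≋ 0² → c ≋ 0²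
    lattice-faithful m-odd zero    c p = subst (_≋ 0²) (lattice-zero c) p
    lattice-faithful m-odd (suc t) c p =
      twist-faithful m-odd (lattice-faithful m-odd t (twist c) (subst (_≋ 0²) (lattice-suc t c) p))

    lattice-injective : IsOdd m → 5 ≤ ∣ m ∣ → ∀ t {c c'} →
      lattice t c ≋ lattice t c' → Bounded c → Bounded c' → c ≡ c'
    lattice-injective odd 5≤m t {c@(α , β)} {c'@(α' , β')} p (α≤2 , β≤2) (α'≤2 , β'≤2) =
      cong₂ _,_ (≈-bounded⇒≡ 5≤m (_≋_.first c≋c') α≤2 α'≤2) (≈-bounded⇒≡ 5≤m (_≋_.second c≋c') β≤2 β'≤2)
      where
      c≋c' : c ≋ c'
      c≋c' = ≋-uncancel (lattice-faithful odd t (c -² c') (subst (_≋ 0²) (lattice-linear t c c') (≋-cancel p)))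

  Generator : Set
  Generator = Fin 4

  coeff : Generator → ℤ²
  coeff zero                   = 1ℤ , 0ℤ
  coeff (suc zero)             = -1ℤ , 0ℤ
  coeff (suc (suc zero))       = 0ℤ , 1ℤ
  coeff (suc (suc (suc zero))) = 0ℤ , -1ℤ

  diff : Generator → Generator → ℤ²
  diff g₁ g₂ = coeff g₁ -² coeff g₂

  infix 4 _≟²_
  _≟²_ : DecidableEquality ℤ²
  _≟²_ = ≡-dec ℤ._≟_ ℤ._≟_

  bounded? : Decidable Bounded
  bounded? (α , β) = (∣ α ∣ ℕ.≤? 2) ×-dec (∣ β ∣ ℕ.≤? 2)

  -- Finite facts about the generators, each checked by evaluating a decision
  -- procedure; sealed so that later type checking never re-runs the search.
  opaque
    coeff-bounded : ∀ g → Bounded (coeff g)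
    coeff-bounded = from-yes (all? λ g → bounded? (coeff g))

    diff-bounded : ∀ g₁ g₂ → Bounded (diff g₁ g₂)
    diff-bounded = from-yes (all? λ g₁ → all? λ g₂ → bounded? (diff g₁ g₂))

    coeff-nonzero : ∀ g → coeff g ≢ 0²
    coeff-nonzero = from-yes (all? λ g → ¬? (coeff g ≟² 0²))

    negation-closed : ∀ g → ∃ λ g' → coeff g' ≡ -² coeff g
    negation-closed = from-yes (all? λ g → any? λ g' → coeff g' ≟² -² coeff g)

    -- No generator is a difference of two generators (a parity obstruction).
    no-triangle : ∀ g g₁ g₂ → coeff g ≢ diff g₁ g₂
    no-triangle = from-yes (all? λ g → all? λ g₁ → all? λ g₂ → ¬? (coeff g ≟² diff g₁ g₂))

    twist-of-difference : ∀ g₁ g₂ g₁' g₂' → diff g₁ g₂ ≡ diff g₁' g₂' → coeff g₁ ≢ coeff g₁' →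
      diff g₁ g₂ ≢ 0² → ∃ λ h → diff g₁ g₂ ≡ twist (coeff h)
    twist-of-difference = from-yes (all? λ g₁ → all? λ g₂ → all? λ g₁' → all? λ g₂' →
      (diff g₁ g₂ ≟² diff g₁' g₂') →-dec ¬? (coeff g₁ ≟² coeff g₁') →-dec ¬? (diff g₁ g₂ ≟² 0²) →-dec
      any? λ h → diff g₁ g₂ ≟² twist (coeff h))

    twist-two-representations : ∀ h → ∃ λ g₁ → ∃ λ g₂ → ∃ λ g₁' → ∃ λ g₂' →
      diff g₁ g₂ ≡ twist (coeff h) × diff g₁' g₂' ≡ twist (coeff h) × coeff g₁ ≢ coeff g₁'
    twist-two-representations = from-yes (all? λ h → any? λ g₁ → any? λ g₂ → any? λ g₁' → any? λ g₂' →
      (diff g₁ g₂ ≟² twist (coeff h)) ×-dec (diff g₁' g₂' ≟² twist (coeff h)) ×-dec ¬? (coeff g₁ ≟² coeff g₁'))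

  module Torus (S K : ℕ) (S-odd : S ≡ 1 ℕ.+ 2 ℕ.* K) (5≤S : 5 ≤ S) where

    open Congruence² (+ S)

    S-isOdd : IsOdd (+ S)
    S-isOdd = + K , trans (cong +_ S-odd) (trans (ℤ.pos-+ 1 (2 ℕ.* K)) (cong (λ n → 1ℤ + n) (ℤ.pos-* 2 K)))

    0<S : 0 < S
    0<S = ℕ.<-≤-trans (ℕ.s≤s ℕ.z≤n) 5≤S

    instance
      S-nonZero : NonZero S
      S-nonZero = ℕ.>-nonZero 0<S

    S≈0 : + S ≈ 0ℤ
    S≈0 = ≈-intro (divides 1ℤ (trans (ℤ.+-identityʳ (+ S)) (sym (ℤ.*-identityˡ (+ S)))))

    residues-congruent⇒equal : ∀ {a b} → a < S → b < S → + a ≈ + b → a ≡ b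
    residues-congruent⇒equal {a} {b} a<S b<S a≈b = ℤ.+-injective (≈-close⇒≡ a≈b close)
      where
      close : ∣ + a - + b ∣ < S
      close = ℕ.≤-<-trans (ℕ.≤-reflexive (cong ∣_∣ (ℤ.m-n≡m⊖n a b)))
                (ℕ.≤-<-trans (ℤ.∣m⊝n∣≤m⊔n a b) (ℕ.⊔-lub a<S b<S))

    pos : Vertex S → ℤ²
    pos (x , y) = + toℕ x , + toℕ y

    δ : Vertex S → Vertex S → ℤ²
    δ u v = pos v -² pos u

    δ-self : ∀ u → δ u u ≡ 0²
    δ-self u = -²-self (pos u)

    δ-flip : ∀ u v → δ v u ≡ -² δ u v
    δ-flip u v = let (a₁ , a₂) = pos u ; (b₁ , b₂) = pos v in cong₂ _,_ (identity a₁ b₁) (identity a₂ b₂)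
      where
      identity : ∀ a b → a - b ≡ - (b - a)
      identity = solve-∀

    δ-split : ∀ u v w → δ u v ≡ δ u w -² δ v w
    δ-split u v w = let (a₁ , a₂) = pos u ; (b₁ , b₂) = pos v ; (c₁ , c₂) = pos w in
      cong₂ _,_ (identity a₁ b₁ c₁) (identity a₂ b₂ c₂)
      where
      identity : ∀ a b c → b - a ≡ (c - a) - (c - b)
      identity = solve-∀

    δ-rebase : ∀ u v w → δ v w ≡ δ u w -² δ u v
    δ-rebase u v w = let (a₁ , a₂) = pos u ; (b₁ , b₂) = pos v ; (c₁ , c₂) = pos w in
      cong₂ _,_ (identity a₁ b₁ c₁) (identity a₂ b₂ c₂)
      where
      identity : ∀ a b c → c - b ≡ (c - a) - (b - a)
      identity = solve-∀

    coordinate-≈0⇒≡ : (x x' : Fin S) → + toℕ x' - + toℕ x ≈ 0ℤ → x ≡ x'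
    coordinate-≈0⇒≡ x x' p = sym (Fin.toℕ-injective (residues-congruent⇒equal (Fin.toℕ<n x') (Fin.toℕ<n x)
      (≈-trans (≈-move (+ toℕ x') (+ toℕ x) p) (≈-reflexive (ℤ.+-identityˡ _)))))

    δ≋0⇒≡ : ∀ u v → δ u v ≋ 0² → u ≡ v
    δ≋0⇒≡ (x , y) (x' , y') (p , q) = cong₂ _,_ (coordinate-≈0⇒≡ x x' p) (coordinate-≈0⇒≡ y y' q)

    residue : ℤ → Fin S
    residue z = fromℕ< (ℤ.n%ℕd<d z S)

    residue-≈ : ∀ z → + toℕ (residue z) ≈ z
    residue-≈ z = ≈-trans (≈-reflexive (cong +_ (Fin.toℕ-fromℕ< (ℤ.n%ℕd<d z S))))
      (≈-trans (≈-intro (divides (- (z ℤ./ℕ S)) (identity (+ (z ℤ.%ℕ S)) (z ℤ./ℕ S) (+ S))))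
               (≈-reflexive (sym (ℤ.a≡a%ℕn+[a/ℕn]*n z S))))
      where
      identity : ∀ r q s → r - (r + q * s) ≡ (- q) * s
      identity = solve-∀

    translate : Vertex S → ℤ² → Vertex S
    translate u z = let (a , b) = pos u +² z in residue a , residue b

    δ-translate : ∀ u z → δ u (translate u z) ≋ z
    δ-translate u z@(z₁ , z₂) = let (a₁ , a₂) = pos u in
        ≈-trans (≈-- (residue-≈ (a₁ + z₁)) ≈-refl) (≈-reflexive (identity a₁ z₁))
      , ≈-trans (≈-- (residue-≈ (a₂ + z₂)) ≈-refl) (≈-reflexive (identity a₂ z₂))
      where
      identity : ∀ a z → (a + z) - a ≡ z
      identity = solve-∀

    successor-difference : ∀ n → + suc n - + n ≡ 1ℤ
    successor-difference n = trans (cong (_- + n) (ℤ.pos-+ 1 n)) (identity (+ n))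
      where
      identity : ∀ a → (1ℤ + a) - a ≡ 1ℤ
      identity = solve-∀

    succMod⇒ : (a b : Fin S) → T (succMod S a b) → + toℕ b - + toℕ a ≈ 1ℤ
    succMod⇒ a b h with Equivalence.to (T-∨ {suc (toℕ a) ℕ.≡ᵇ toℕ b}) h
    ... | inj₁ a+1≡b = ≈-reflexive
      (trans (cong (λ n → + n - + toℕ a) (sym (ℕ.≡ᵇ⇒≡ _ _ a+1≡b))) (successor-difference (toℕ a)))
    ... | inj₂ wraps with Equivalence.to (T-∧ {suc (toℕ a) ℕ.≡ᵇ S}) wraps
    ...   | a+1≡S , b≡0 =
      ≈-trans (≈-reflexive (cong (λ n → + n - + toℕ a) (ℕ.≡ᵇ⇒≡ (toℕ b) 0 b≡0)))
        (≈-trans (≈-- (≈-sym S≈0) (≈-refl {+ toℕ a}))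
          (≈-reflexive (trans (cong (λ n → + n - + toℕ a) (sym (ℕ.≡ᵇ⇒≡ _ _ a+1≡S))) (successor-difference (toℕ a)))))

    succMod⇐ : (a b : Fin S) → + toℕ b - + toℕ a ≈ 1ℤ → T (succMod S a b)
    succMod⇐ a b p with ℕ.m≤n⇒m<n∨m≡n (Fin.toℕ<n a)
    ... | inj₁ a+1<S = Equivalence.from T-∨ (inj₁ (ℕ.≡⇒≡ᵇ _ _ (sym b≡a+1)))
      where
      b≡a+1 : toℕ b ≡ suc (toℕ a)
      b≡a+1 = residues-congruent⇒equal (Fin.toℕ<n b) a+1<S
        (≈-trans (≈-move (+ toℕ b) (+ toℕ a) p) (≈-reflexive (sym (ℤ.pos-+ 1 (toℕ a)))))
    ... | inj₂ a+1≡S = Equivalence.from T-∨ (inj₂ (Equivalence.from T-∧ (ℕ.≡⇒≡ᵇ _ _ a+1≡S , ℕ.≡⇒≡ᵇ _ _ b≡0)))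
      where
      b≡0 : toℕ b ≡ 0
      b≡0 = residues-congruent⇒equal (Fin.toℕ<n b) 0<S
        (≈-trans (≈-move (+ toℕ b) (+ toℕ a) p) (≈-trans (≈-reflexive (trans (sym (ℤ.pos-+ 1 (toℕ a))) (cong +_ a+1≡S))) S≈0))

    pm1⇒ : (a b : Fin S) → T (pm1 S a b) → (+ toℕ b - + toℕ a ≈ 1ℤ) ⊎ (+ toℕ b - + toℕ a ≈ -1ℤ)
    pm1⇒ a b h with Equivalence.to (T-∨ {succMod S a b}) h
    ... | inj₁ forward  = inj₁ (succMod⇒ a b forward)
    ... | inj₂ backward = inj₂ (≈-flip (+ toℕ a) (+ toℕ b) (succMod⇒ b a backward))

    pm1⇐ : (a b : Fin S) → (+ toℕ b - + toℕ a ≈ 1ℤ) ⊎ (+ toℕ b - + toℕ a ≈ -1ℤ) → T (pm1 S a b)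
    pm1⇐ a b (inj₁ p) = Equivalence.from T-∨ (inj₁ (succMod⇐ a b p))
    pm1⇐ a b (inj₂ p) = Equivalence.from (T-∨ {succMod S a b}) (inj₂ (succMod⇐ b a (≈-flip (+ toℕ b) (+ toℕ a) p)))

    same⇒ : (x x' : Fin S) → T ⌊ x Fin.≟ x' ⌋ → + toℕ x' - + toℕ x ≈ 0ℤ
    same⇒ x x' h rewrite toWitness h = ≈-reflexive (ℤ.+-inverseʳ (+ toℕ x'))

    same⇐ : (x x' : Fin S) → + toℕ x' - + toℕ x ≈ 0ℤ → T ⌊ x Fin.≟ x' ⌋
    same⇐ x x' p = fromWitness (coordinate-≈0⇒≡ x x' p)

    torus⇒ : ∀ u v → T (torus S u v) → ∃ λ g → δ u v ≋ coeff g
    torus⇒ (x , y) (x' , y') h with Equivalence.to (T-∨ {⌊ x Fin.≟ x' ⌋ ∧ pm1 S y y'}) h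
    ... | inj₁ vertical with Equivalence.to (T-∧ {⌊ x Fin.≟ x' ⌋}) vertical
    ...   | same-x , step-y with pm1⇒ y y' step-y
    ...     | inj₁ up   = suc (suc zero) , same⇒ x x' same-x , up
    ...     | inj₂ down = suc (suc (suc zero)) , same⇒ x x' same-x , down
    torus⇒ (x , y) (x' , y') h | inj₂ horizontal with Equivalence.to (T-∧ {⌊ y Fin.≟ y' ⌋}) horizontal
    ...   | same-y , step-x with pm1⇒ x x' step-x
    ...     | inj₁ right = zero , right , same⇒ y y' same-y
    ...     | inj₂ left  = suc zero , left , same⇒ y y' same-y

    torus⇐ : ∀ u v → (∃ λ g → δ u v ≋ coeff g) → T (torus S u v)
    torus⇐ (x , y) (x' , y') (zero , p , q) = Equivalence.from (T-∨ {⌊ x Fin.≟ x' ⌋ ∧ pm1 S y y'})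
      (inj₂ (Equivalence.from T-∧ (same⇐ y y' q , pm1⇐ x x' (inj₁ p))))
    torus⇐ (x , y) (x' , y') (suc zero , p , q) = Equivalence.from (T-∨ {⌊ x Fin.≟ x' ⌋ ∧ pm1 S y y'})
      (inj₂ (Equivalence.from T-∧ (same⇐ y y' q , pm1⇐ x x' (inj₂ p))))
    torus⇐ (x , y) (x' , y') (suc (suc zero) , p , q) =
      Equivalence.from T-∨ (inj₁ (Equivalence.from T-∧ (same⇐ x x' p , pm1⇐ y y' (inj₁ q))))
    torus⇐ (x , y) (x' , y') (suc (suc (suc zero)) , p , q) =
      Equivalence.from T-∨ (inj₁ (Equivalence.from T-∧ (same⇐ x x' p , pm1⇐ y y' (inj₂ q))))

    coefficients-unique : ∀ t {c c'} → lattice t c ≋ lattice t c' → Bounded c → Bounded c' → c ≡ c'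
    coefficients-unique = lattice-injective S-isOdd 5≤S

    gen : ℕ → Generator → ℤ²
    gen t g = lattice t (coeff g)

    record Adj (t : ℕ) (u v : Vertex S) : Set where
      constructor _,_
      field
        generator    : Generator
        displacement : δ u v ≋ gen t generator

    adj-irreflexive : ∀ {t u v} → Adj t u v → u ≢ v
    adj-irreflexive {t} {u} (g , p) refl = coeff-nonzero g
      (coefficients-unique t (≋-trans (≋-sym p) (≋-reflexive (trans (δ-self u) (sym (lattice-null t)))))
        (coeff-bounded g) (ℕ.z≤n , ℕ.z≤n))

    adj-sym : ∀ {t u v} → Adj t u v → Adj t v u
    adj-sym {t} {u} {v} (g , p) = let (g' , g'≡-g) = negation-closed g in
      g' , ≋-trans (≋-reflexive (δ-flip u v))
             (≋-trans (≋-neg p) (≋-reflexive (sym (trans (cong (lattice t) g'≡-g) (lattice-neg t (coeff g))))))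

    Represents : ℕ → Graph S → Set
    Represents t G = ∀ u v → T (G u v) ⇔ Adj t u v

    represents-torus : Represents 0 (torus S)
    represents-torus u v = mk⇔
      (λ h → let (g , p) = torus⇒ u v h in g , ≋-trans p (≋-reflexive (sym (lattice-zero (coeff g)))))
      (λ (g , p) → torus⇐ u v (g , ≋-trans p (≋-reflexive (lattice-zero (coeff g)))))

    twist-as-difference : ∀ {t u v} ((h , p) : Adj (suc t) u v) g₁ g₂ → diff g₁ g₂ ≡ twist (coeff h) →
      δ u v ≋ lattice t (diff g₁ g₂)
    twist-as-difference {t} (h , p) g₁ g₂ e =
      ≋-trans p (≋-reflexive (trans (lattice-suc t (coeff h)) (cong (lattice t) (sym e))))

    step-towards : ∀ {t u v} g₁ g₂ → δ u v ≋ lattice t (diff g₁ g₂) →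
      let w = translate u (gen t g₁) in Adj t u w × Adj t v w
    step-towards {t} {u} {v} g₁ g₂ q = (g₁ , p) , (g₂ , r)
      where
      w : Vertex S
      w = translate u (gen t g₁)
      p : δ u w ≋ gen t g₁
      p = δ-translate u (gen t g₁)
      r : δ v w ≋ gen t g₂
      r = ≋-trans (≋-reflexive (δ-rebase u v w)) (≋-trans (≋-- p q) (≋-reflexive
            (trans (lattice-linear t (coeff g₁) (diff g₁ g₂)) (cong (lattice t) (-²-cancelˡ (coeff g₁) (coeff g₂))))))

    distinct-steps : ∀ {t} u g₁ g₁' → coeff g₁ ≢ coeff g₁' → translate u (gen t g₁) ≢ translate u (gen t g₁')
    distinct-steps {t} u g₁ g₁' different same = different (coefficients-unique t
      (≋-trans (≋-sym (δ-translate u (gen t g₁)))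
               (subst (λ w → δ u w ≋ gen t g₁') (sym same) (δ-translate u (gen t g₁'))))
      (coeff-bounded g₁) (coeff-bounded g₁'))

    two-differences⇒adj-next : ∀ {t u v w₁ w₂} g₁ g₂ g₁' g₂' → u ≢ v → w₁ ≢ w₂ →
      δ u w₁ ≋ gen t g₁ → δ u v ≋ lattice t (diff g₁ g₂) →
      δ u w₂ ≋ gen t g₁' → δ u v ≋ lattice t (diff g₁' g₂') → Adj (suc t) u v
    two-differences⇒adj-next {t} {u} {v} {w₁} {w₂} g₁ g₂ g₁' g₂' u≢v w₁≢w₂ p q p' q' =
      next-generator (twist-of-difference g₁ g₂ g₁' g₂' same-difference different-first-steps nonzero)
      where
      same-difference : diff g₁ g₂ ≡ diff g₁' g₂'
      same-difference = coefficients-unique t (≋-trans (≋-sym q) q') (diff-bounded g₁ g₂) (diff-bounded g₁' g₂')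

      different-first-steps : coeff g₁ ≢ coeff g₁'
      different-first-steps e = w₁≢w₂ (δ≋0⇒≡ w₁ w₂ (≋-trans (≋-reflexive (δ-rebase u w₁ w₂))
        (≋-trans (≋-- p' p) (≋-reflexive (trans (cong (λ c → lattice t c -² gen t g₁) (sym e)) (-²-self (gen t g₁)))))))

      nonzero : diff g₁ g₂ ≢ 0²
      nonzero e = u≢v (δ≋0⇒≡ u v (≋-trans q (≋-reflexive (trans (cong (lattice t) e) (lattice-null t)))))

      next-generator : (∃ λ h → diff g₁ g₂ ≡ twist (coeff h)) → Adj (suc t) u v
      next-generator (h , d≡twist) =
        h , ≋-trans q (≋-reflexive (trans (cong (lattice t) d≡twist) (sym (lattice-suc t (coeff h)))))

    module _ {t} {G : Graph S} (rep : Represents t G) where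

      represents-sym : ∀ {u v} → T (G u v) → T (G v u)
      represents-sym {u} {v} h = Equivalence.from (rep v u) (adj-sym (Equivalence.to (rep u v) h))

      common⇒difference : ∀ {u v w} → T (G u w) → T (G v w) →
        ∃ λ g₁ → ∃ λ g₂ → δ u w ≋ gen t g₁ × δ u v ≋ lattice t (diff g₁ g₂)
      common⇒difference {u} {v} {w} uw vw =
        let (g₁ , p₁) = Equivalence.to (rep u w) uw ; (g₂ , p₂) = Equivalence.to (rep v w) vw in
        g₁ , g₂ , p₁ , ≋-trans (≋-reflexive (δ-split u v w))
                         (≋-trans (≋-- p₁ p₂) (≋-reflexive (lattice-linear t (coeff g₁) (coeff g₂))))

      -- (i): an edge uv has no common neighbour, since no generator is a difference of two.
      triangle-free : ∀ {u v} → T (G u v) → commonNbrs G u v ≡ []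
      triangle-free {u} {v} uv = Counting.no-member⇒empty (λ w → G u w ∧ G v w) (vertices S) no-common
        where
        no-common : ∀ w → ¬ T (G u w ∧ G v w)
        no-common w uvw =
          let (uw , vw) = Equivalence.to T-∧ uvw
              (g , p) = Equivalence.to (rep u v) uv
              (g₁ , g₂ , _ , q) = common⇒difference uw vw
          in no-triangle g g₁ g₂ (coefficients-unique t (≋-trans (≋-sym p) q) (coeff-bounded g) (diff-bounded g₁ g₂))

      two-common⇒adj-next : ∀ {u v w₁ w₂} → u ≢ v → w₁ ≢ w₂ →
        T (G u w₁) → T (G v w₁) → T (G u w₂) → T (G v w₂) → Adj (suc t) u v
      two-common⇒adj-next u≢v w₁≢w₂ uw₁ vw₁ uw₂ vw₂ =
        let (g₁ , g₂ , p , q) = common⇒difference uw₁ vw₁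
            (g₁' , g₂' , p' , q') = common⇒difference uw₂ vw₂
        in two-differences⇒adj-next g₁ g₂ g₁' g₂' u≢v w₁≢w₂ p q p' q'

      adj-next⇒two-common : ∀ {u v} → Adj (suc t) u v →
        ∃ λ w₁ → ∃ λ w₂ → w₁ ≢ w₂ × T (G u w₁ ∧ G v w₁) × T (G u w₂ ∧ G v w₂)
      adj-next⇒two-common {u} {v} adj@(h , _) =
        let (g₁ , g₂ , g₁' , g₂' , e , e' , different) = twist-two-representations h
            c = step-towards g₁ g₂ (twist-as-difference adj g₁ g₂ e)
            c' = step-towards g₁' g₂' (twist-as-difference adj g₁' g₂' e')
        in _ , _ , distinct-steps {t} u g₁ g₁' different , common c , common c'
        where
        common : ∀ {w} → Adj t u w × Adj t v w → T (G u w ∧ G v w)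
        common (uw , vw) = Equivalence.from T-∧ (Equivalence.from (rep _ _) uw , Equivalence.from (rep _ _) vw)

      -- The first energy reaches 2 exactly at the time-(t+1) generators, and every old
      -- edge lies in C, so no pair outside C keeps an edge.
      represents-step₁ : Represents (suc t) (step energy₁ G)
      represents-step₁ u v = mk⇔ forward backward
        where
        forward : T (step energy₁ G u v) → Adj (suc t) u v
        forward h = [ from-common , from-old-edge ]′ (T-if (inC G u v) h)
          where
          from-common : T (inC G u v) × T (2 ℕ.≤ᵇ energy₁ G u v) → Adj (suc t) u v
          from-common (inC-uv , enough) =
            let (w₁ , w₂ , w₁≢w₂ , c₁ , c₂) = Counting.2≤count⇒members (λ w → G u w ∧ G v w) (vertices S)
                                                 (vertices-unique S) (ℕ.≤ᵇ⇒≤ 2 _ enough)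
                (uw₁ , vw₁) = Equivalence.to T-∧ c₁
                (uw₂ , vw₂) = Equivalence.to T-∧ c₂
            in two-common⇒adj-next (inC⇒≢ G u v inC-uv) w₁≢w₂ uw₁ vw₁ uw₂ vw₂
          from-old-edge : ¬ T (inC G u v) × T (G u v) → Adj (suc t) u v
          from-old-edge (not-inC , uv) =
            ⊥-elim (not-inC (edge⇒inC G (adj-irreflexive (Equivalence.to (rep u v) uv)) uv))

        backward : Adj (suc t) u v → T (step energy₁ G u v)
        backward adj =
          let (w₁ , w₂ , w₁≢w₂ , c₁ , c₂) = adj-next⇒two-common adj
              (uw₁ , vw₁) = Equivalence.to T-∧ c₁
          in T-if-then (inC G u v)
               (path⇒inC G (adj-irreflexive adj) uw₁ (represents-sym vw₁))
               (ℕ.≤⇒≤ᵇ (Counting.members⇒2≤count (λ w → G u w ∧ G v w) (vertices S)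
                         (vertex∈vertices w₁) (vertex∈vertices w₂) w₁≢w₂ c₁ c₂))

      -- By (i) the second energy makes the same decisions as the first.
      step-energies-agree : ∀ u v → step energy₂ G u v ≡ step energy₁ G u v
      step-energies-agree u v = if-cong-then (inC G u v) (energies-agree-at-2 G u v triangle-free)

      represents-step₂ : Represents (suc t) (step energy₂ G)
      represents-step₂ u v =
        subst (λ b → T b ⇔ Adj (suc t) u v) (sym (step-energies-agree u v)) (represents-step₁ u v)

    represents-process : (E : Energy) → (∀ {t G} → Represents t G → Represents (suc t) (step E G)) →
      ∀ t → Represents t (process E S t)
    represents-process E preserves zero    = represents-torus
    represents-process E preserves (suc t) = preserves (represents-process E preserves t)

    represents-unique : ∀ {t G H} → Represents t G → Represents t H → ∀ u v → G u v ≡ H u v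
    represents-unique repG repH u v = T-injective
      (Equivalence.from (repH u v) ∘ Equivalence.to (repG u v))
      (Equivalence.from (repG u v) ∘ Equivalence.to (repH u v))

open import Data.Nat using (_≤_; _*_; _+_)
open import Data.Nat.Divisibility using (_∣_)

lemma11 : (S : ℕ) → (∃ λ k → S ≡ 1 + 2 * k) → 5 ≤ S → ¬ (3 ∣ S) →
    (t : ℕ) → (u v : Vertex S) →
      process energy₁ S t u v ≡ process energy₂ S t u v
lemma11 S (K , S-odd) 5≤S _ t = represents-unique
  (represents-process energy₁ represents-step₁ t)
  (represents-process energy₂ represents-step₂ t)
  where open Lattice.Torus S K S-odd 5≤S
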